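{- Let $G=(V,E)$ be a non-bipartite graph and let $\Gamma=\{\{v\}:v\in V\}$ be the single-vertex partitioning. With node utilities, $\mathrm{SF\text{ - }MP}(G,\Gamma)\le\frac{\Delta(G)-1}{\Delta(G)}$.
   Context: Max-Cut with node utilities: $\Delta(G)$ is the maximum degree of $G$ and $N(v)$ the neighborhood of $v$. A cut is $S\subseteq V$; $X_{uv}(S)=1$ if exactly one of $u,v$ lies in $S$ and $0$ otherwise. Node utility: $f_S(v)=\frac{1}{\Delta(G)}\sum_{u\in N(v)}X_{uv}(S)$, $f_S(A)=\sum_{v\in A}f_S(v)$. For a vertex partition $\Gamma=\{V_1,\ldots,V_\gamma\}$, $\mathrm{SF\text{ - }MP}(G,\Gamma)=\max_{S\subseteq V}\min_{i\in[\gamma]}f_S(V_i)/|V_i|$. -}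

module Defs where

open import Data.Bool using (Bool; true; false; _∧_; _xor_; T; if_then_else_)
open import Data.Nat as ℕ using (ℕ; zero; suc; _∸_)
open import Data.Integer using (+_)
open import Data.Fin using (Fin)
open import Data.Fin.Subset using (Subset; ⁅_⁆; ∣_∣)
open import Data.Vec using (Vec; []; _∷_; lookup)
open import Data.List using (List; []; _∷_; map; foldr; allFin; _++_)
open import Data.Rational as ℚ using (ℚ; 0ℚ)
open import Data.Product using (Σ; _×_)
open import Relation.Binary.PropositionalEquality using (_≡_)
open import Relation.Nullary using (¬_)

record Graph (n : ℕ) : Set where
  field
    Adj   : Fin n → Fin n → Bool
    sym   : ∀ u v → Adj u v ≡ Adj v u
    irrefl : ∀ v → Adj v v ≡ false
open Graph public

Σᵥ : ∀ {n} → (Fin n → ℕ) → ℕ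
Σᵥ {n} f = foldr (λ v acc → f v ℕ.+ acc) 0 (allFin n)

Σqᵥ : ∀ {n} → (Fin n → ℚ) → ℚ
Σqᵥ {n} f = foldr (λ v acc → f v ℚ.+ acc) 0ℚ (allFin n)

deg : ∀ {n} → Graph n → Fin n → ℕ
deg G v = Σᵥ (λ u → if Adj G v u then 1 else 0)

Δ : ∀ {n} → Graph n → ℕ
Δ {n} G = foldr (λ v acc → deg G v ℕ.⊔ acc) 0 (allFin n)

Bipartite : ∀ {n} → Graph n → Set
Bipartite {n} G = Σ (Fin n → Bool) λ c → ∀ u v → T (Adj G u v) → ¬ (c u ≡ c v)

-- k / d as a rational; convention k / 0 = 0 (only used when d = 0,
-- i.e. never under the theorem's hypotheses).
frac : ℕ → ℕ → ℚ
frac k zero = 0ℚ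
frac k (suc d) = (+ k) ℚ./ suc d

X : ∀ {n} → Subset n → Fin n → Fin n → Bool
X S u v = lookup S u xor lookup S v

cutDeg : ∀ {n} → Graph n → Subset n → Fin n → ℕ
cutDeg G S v = Σᵥ (λ u → if Adj G v u ∧ X S u v then 1 else 0)

f : ∀ {n} → Graph n → Subset n → Fin n → ℚ
f G S v = frac (cutDeg G S v) (Δ G)

fSet : ∀ {n} → Graph n → Subset n → Subset n → ℚ
fSet G S A = Σqᵥ (λ v → if lookup A v then f G S v else 0ℚ)

-- q / |A| (|A| ≥ 1 for parts of a partition)
divCard : ℚ → ℕ → ℚ
divCard q zero = 0ℚ
divCard q (suc k) = q ℚ.* ((+ 1) ℚ./ suc k)

allSubsets : (n : ℕ) → List (Subset n)
allSubsets zero = [] ∷ []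
allSubsets (suc n) = map (true ∷_) (allSubsets n) ++ map (false ∷_) (allSubsets n)

-- minimum / maximum of a list of rationals (empty list ↦ 0, never used
-- for nonempty vertex sets)
minList : List ℚ → ℚ
minList [] = 0ℚ
minList (x ∷ xs) = foldr ℚ._⊓_ x xs

maxList : List ℚ → ℚ
maxList [] = 0ℚ
maxList (x ∷ xs) = foldr ℚ._⊔_ x xs

Partition : ℕ → Set
Partition n = List (Subset n)

SF-MP : ∀ {n} → Graph n → Partition n → ℚ
SF-MP {n} G Γ = maxList (map (λ S → minList (map (λ A → divCard (fSet G S A) ∣ A ∣) Γ)) (allSubsets n))

singletonPartition : (n : ℕ) → Partition n
singletonPartition n = map ⁅_⁆ (allFin n)

{-# OPTIONS --safe #-}
module Submission where

-- A cut is a 2-colouring of the vertices. As G is not bipartite, every cut leaves some edge vu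
-- uncut, so v has at most deg v - 1 <= Δ - 1 cut edges and f_S(v) <= (Δ - 1)/Δ. For the
-- single-vertex partition f_S(v) is one of the values being minimised, so every cut, and hence
-- the best one, has value at most (Δ - 1)/Δ.

open import Defs
open import Data.Nat using (ℕ; _∸_)
open import Data.Rational using (_≤_)
open import Relation.Nullary using (¬_)

open import Data.Bool using (Bool; true; false; _∧_; T; if_then_else_)
open import Data.Bool.Properties using (T?; T-≡; xor-same) renaming (_≟_ to _≟ᵇ_)
open import Data.Empty using (⊥-elim)
open import Data.Fin using (Fin; zero; suc)
open import Data.Fin.Properties using (any?)
open import Data.Fin.Subset using (Subset; ⁅_⁆; ∣_∣; ⊥)
open import Data.Fin.Subset.Properties using (∣⁅x⁆∣≡1)
open import Data.Integer using (+_; +≤+)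
open import Data.Integer.Properties using (*-monoʳ-≤-nonNeg)
open import Data.List using (List; []; _∷_; map; foldr; allFin)
open import Data.List.Properties using (foldr-map; map-tabulate)
open import Data.List.Membership.Propositional using (_∈_)
open import Data.List.Membership.Propositional.Properties using (∈-allFin; ∈-map⁺)
open import Data.List.Relation.Unary.All as All using (All; []; _∷_)
open import Data.List.Relation.Unary.All.Properties using (map⁺)
open import Data.List.Relation.Unary.Any using (here; there)
open import Data.Nat as ℕ using (suc; _<_; _⊔_; _+_; s≤s; z≤n)
import Data.Nat.Properties as ℕ
open import Data.Product using (∃₂; _×_; _,_)
open import Data.Rational as ℚ using (ℚ; 0ℚ; _⊓_)
import Data.Rational.Properties as ℚ
open import Data.Rational.Unnormalised as ℚᵘ using (mkℚᵘ; *≤*)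
import Data.Rational.Unnormalised.Properties as ℚᵘ
open import Data.Vec using (lookup)
open import Function using (id; _∘_; Equivalence)
open import Relation.Nullary using (yes; no)
open import Relation.Nullary.Decidable using (_×-dec_)
open import Relation.Binary.PropositionalEquality as ≡ using (_≡_; refl; cong)

private variable
  n k m : ℕ

0≤frac : ∀ k d → 0ℚ ≤ frac k d
0≤frac k ℕ.zero    = ℚ.≤-refl
0≤frac k (suc d) = ℚ.nonNegative⁻¹ _ {{ℚ.normalize-nonNeg k (suc d)}}

frac-monoˡ-≤ : ∀ d → k ℕ.≤ m → frac k d ≤ frac m d
frac-monoˡ-≤ ℕ.zero _ = ℚ.≤-refl
frac-monoˡ-≤ {k} {m} (suc d) k≤m = ℚ.toℚᵘ-cancel-≤ (begin
  ℚ.toℚᵘ (ℚ.fromℚᵘ (mkℚᵘ (+ k) d))  ≃⟨ ℚ.toℚᵘ-fromℚᵘ (mkℚᵘ (+ k) d) ⟩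
  mkℚᵘ (+ k) d                      ≤⟨ *≤* (*-monoʳ-≤-nonNeg (+ suc d) (+≤+ k≤m)) ⟩
  mkℚᵘ (+ m) d                      ≃⟨ ℚ.toℚᵘ-fromℚᵘ (mkℚᵘ (+ m) d) ⟨
  ℚ.toℚᵘ (ℚ.fromℚᵘ (mkℚᵘ (+ m) d))  ∎)
  where open ℚᵘ.≤-Reasoning

frac-≤-pred : k < m → frac k m ≤ frac (m ∸ 1) m
frac-≤-pred {m = suc m} (s≤s k≤m) = frac-monoˡ-≤ (suc m) k≤m

foldr-⊔-lub : ∀ {x b} {xs : List ℚ} → x ≤ b → All (_≤ b) xs → foldr ℚ._⊔_ x xs ≤ b
foldr-⊔-lub x≤b []         = x≤b
foldr-⊔-lub x≤b (y≤b ∷ ys) = ℚ.⊔-lub y≤b (foldr-⊔-lub x≤b ys)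

maxList-lub : ∀ {b} {xs : List ℚ} → 0ℚ ≤ b → All (_≤ b) xs → maxList xs ≤ b
maxList-lub 0≤b []         = 0≤b
maxList-lub 0≤b (x≤b ∷ xs) = foldr-⊔-lub x≤b xs

foldr-⊓-≤ : ∀ {x y} xs → y ∈ x ∷ xs → foldr _⊓_ x xs ≤ y
foldr-⊓-≤ []       (here refl)         = ℚ.≤-refl
foldr-⊓-≤ (z ∷ xs) (here refl)         = ℚ.≤-trans (ℚ.p⊓q≤q z _) (foldr-⊓-≤ xs (here refl))
foldr-⊓-≤ (z ∷ xs) (there (here refl)) = ℚ.p⊓q≤p z _
foldr-⊓-≤ (z ∷ xs) (there (there y∈))  = ℚ.≤-trans (ℚ.p⊓q≤q z _) (foldr-⊓-≤ xs (there y∈))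

minList-≤ : ∀ {y} {xs : List ℚ} → y ∈ xs → minList xs ≤ y
minList-≤ {xs = x ∷ xs} y∈ = foldr-⊓-≤ xs y∈

foldr-allFin-suc : ∀ {B : Set} (step : Fin (suc n) → B → B) e →
  foldr step e (allFin (suc n)) ≡ step zero (foldr (step ∘ suc) e (allFin n))
foldr-allFin-suc {n} step e = cong (step zero) (≡.trans
  (cong (foldr step e) (≡.sym (map-tabulate id suc)))
  (foldr-map step suc e (allFin n)))

Σqᵥ-suc : (h : Fin (suc n) → ℚ) → Σqᵥ h ≡ h zero ℚ.+ Σqᵥ (h ∘ suc)
Σqᵥ-suc h = foldr-allFin-suc (λ v acc → h v ℚ.+ acc) 0ℚ

restrict : Subset n → (Fin n → ℚ) → Fin n → ℚ
restrict A h w = if lookup A w then h w else 0ℚ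

Σqᵥ-restrict-⊥ : (h : Fin n → ℚ) → Σqᵥ (restrict ⊥ h) ≡ 0ℚ
Σqᵥ-restrict-⊥ {ℕ.zero}  h = refl
Σqᵥ-restrict-⊥ {suc n} h = begin
  Σqᵥ (restrict ⊥ h)               ≡⟨ Σqᵥ-suc (restrict ⊥ h) ⟩
  0ℚ ℚ.+ Σqᵥ (restrict ⊥ (h ∘ suc)) ≡⟨ ℚ.+-identityˡ _ ⟩
  Σqᵥ (restrict ⊥ (h ∘ suc))        ≡⟨ Σqᵥ-restrict-⊥ (h ∘ suc) ⟩
  0ℚ                                ∎
  where open ≡.≡-Reasoning

Σqᵥ-restrict-⁅⁆ : (v : Fin n) (h : Fin n → ℚ) → Σqᵥ (restrict ⁅ v ⁆ h) ≡ h v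
Σqᵥ-restrict-⁅⁆ {suc n} zero h = begin
  Σqᵥ (restrict ⁅ zero ⁆ h)            ≡⟨ Σqᵥ-suc (restrict ⁅ zero ⁆ h) ⟩
  h zero ℚ.+ Σqᵥ (restrict ⊥ (h ∘ suc)) ≡⟨ cong (h zero ℚ.+_) (Σqᵥ-restrict-⊥ (h ∘ suc)) ⟩
  h zero ℚ.+ 0ℚ                        ≡⟨ ℚ.+-identityʳ (h zero) ⟩
  h zero                               ∎
  where open ≡.≡-Reasoning
Σqᵥ-restrict-⁅⁆ {suc n} (suc v) h = begin
  Σqᵥ (restrict ⁅ suc v ⁆ h)            ≡⟨ Σqᵥ-suc (restrict ⁅ suc v ⁆ h) ⟩
  0ℚ ℚ.+ Σqᵥ (restrict ⁅ v ⁆ (h ∘ suc)) ≡⟨ ℚ.+-identityˡ _ ⟩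
  Σqᵥ (restrict ⁅ v ⁆ (h ∘ suc))        ≡⟨ Σqᵥ-restrict-⁅⁆ v (h ∘ suc) ⟩
  h (suc v)                            ∎
  where open ≡.≡-Reasoning

divCard-fSet-⁅⁆ : (G : Graph n) (S : Subset n) (v : Fin n) →
  divCard (fSet G S ⁅ v ⁆) ∣ ⁅ v ⁆ ∣ ≡ f G S v
divCard-fSet-⁅⁆ G S v rewrite ∣⁅x⁆∣≡1 v =
  ≡.trans (ℚ.*-identityʳ _) (Σqᵥ-restrict-⁅⁆ v (f G S))

module _ {A : Set} where

  sumBy : (A → ℕ) → List A → ℕ
  sumBy h = foldr (λ v acc → h v + acc) 0

  sumBy-mono-≤ : ∀ {g h : A → ℕ} → (∀ w → g w ℕ.≤ h w) → ∀ xs → sumBy g xs ℕ.≤ sumBy h xs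
  sumBy-mono-≤ g≤h []       = z≤n
  sumBy-mono-≤ g≤h (x ∷ xs) = ℕ.+-mono-≤ (g≤h x) (sumBy-mono-≤ g≤h xs)

  sumBy-mono-< : ∀ {g h : A → ℕ} → (∀ w → g w ℕ.≤ h w) →
    ∀ {u xs} → u ∈ xs → g u < h u → sumBy g xs < sumBy h xs
  sumBy-mono-< g≤h {xs = x ∷ xs} (here refl) gu<hu = ℕ.+-mono-<-≤ gu<hu (sumBy-mono-≤ g≤h xs)
  sumBy-mono-< g≤h {xs = x ∷ xs} (there u∈)  gu<hu = ℕ.+-mono-≤-< (g≤h x) (sumBy-mono-< g≤h u∈ gu<hu)

  ≤-foldr-⊔ : ∀ (h : A → ℕ) {u xs} → u ∈ xs → h u ℕ.≤ foldr (λ v acc → h v ⊔ acc) 0 xs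
  ≤-foldr-⊔ h {xs = x ∷ xs} (here refl) = ℕ.m≤m⊔n (h x) _
  ≤-foldr-⊔ h {xs = x ∷ xs} (there u∈)  = ℕ.≤-trans (≤-foldr-⊔ h u∈) (ℕ.m≤n⊔m (h x) _)

deg≤Δ : (G : Graph n) (v : Fin n) → deg G v ℕ.≤ Δ G
deg≤Δ G v = ≤-foldr-⊔ (deg G) (∈-allFin v)

¬bipartite⇒monochromatic-edge : (G : Graph n) → ¬ Bipartite G →
  (c : Fin n → Bool) → ∃₂ λ v u → T (Adj G v u) × c v ≡ c u
¬bipartite⇒monochromatic-edge G ¬bip c
  with any? (λ v → any? (λ u → T? (Adj G v u) ×-dec (c v ≟ᵇ c u)))
... | yes edge = edge
... | no ¬edge = ⊥-elim (¬bip (c , λ v u vu same → ¬edge (v , u , vu , same)))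

cut-indicator≤ : ∀ a x → (if a ∧ x then 1 else 0) ℕ.≤ (if a then 1 else 0)
cut-indicator≤ true  true  = s≤s z≤n
cut-indicator≤ true  false = z≤n
cut-indicator≤ false x     = z≤n

cutDeg<deg : (G : Graph n) (S : Subset n) {v u : Fin n} →
  T (Adj G v u) → lookup S v ≡ lookup S u → cutDeg G S v < deg G v
cutDeg<deg G S {v} {u} vu same =
  sumBy-mono-< (λ w → cut-indicator≤ (Adj G v w) (X S w v)) (∈-allFin u) uncut
  where
  uncut : (if Adj G v u ∧ X S u v then 1 else 0) < (if Adj G v u then 1 else 0)
  uncut rewrite Equivalence.to T-≡ vu | same | xor-same (lookup S u) = s≤s z≤n

cutValue : Graph n → Partition n → Subset n → ℚ
cutValue G Γ S = minList (map (λ A → divCard (fSet G S A) ∣ A ∣) Γ)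

cutValue-singletons≤ : (G : Graph n) → ¬ Bipartite G → (S : Subset n) →
  cutValue G (singletonPartition n) S ≤ frac (Δ G ∸ 1) (Δ G)
cutValue-singletons≤ {n} G ¬bip S with ¬bipartite⇒monochromatic-edge G ¬bip (lookup S)
... | v , u , vu , same = begin
  cutValue G (singletonPartition n) S  ≤⟨ minList-≤ (∈-map⁺ _ (∈-map⁺ ⁅_⁆ (∈-allFin v))) ⟩
  divCard (fSet G S ⁅ v ⁆) ∣ ⁅ v ⁆ ∣   ≡⟨ divCard-fSet-⁅⁆ G S v ⟩
  f G S v                             ≤⟨ frac-≤-pred (ℕ.<-≤-trans (cutDeg<deg G S vu same) (deg≤Δ G v)) ⟩
  frac (Δ G ∸ 1) (Δ G)                ∎
  where open ℚ.≤-Reasoning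

proposition4p12 : ∀ (n : ℕ) (G : Graph n) → ¬ Bipartite G →
    SF-MP G (singletonPartition n) ≤ frac (Δ G ∸ 1) (Δ G)
proposition4p12 n G ¬bip = maxList-lub (0≤frac (Δ G ∸ 1) (Δ G))
  (map⁺ (All.universal (cutValue-singletons≤ G ¬bip) (allSubsets n)))
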